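{- Let $\langle A,\land,\lor,\to,\sim,1\rangle$ be a Nelson algebra. Define $x\rightarrowtail y:=(x\to y)\land(\sim y\to\sim x)$, $x\land_B y:=x\land y$ and $0:=\sim 1$. Then $\langle A,\land_B,\rightarrowtail,0\rangle$ is a Brignole algebra.
   Context: A Nelson algebra is an algebra $\langle A,\land,\lor,\to,\sim,1\rangle$ of type $(2,2,2,1,0)$ satisfying, for all $x,y,z$: (N1) $x\land(x\lor y)=x$; (N2) $x\land(y\lor z)=(z\land x)\lor(y\land x)$; (N3) $\sim\sim x=x$; (N4) $\sim(x\land y)=\sim x\lor\sim y$; (N5) $x\land\sim x=(x\land\sim x)\land(y\lor\sim y)$; (N6) $x\to x=1$; (N7) $x\land(x\to y)=x\land(\sim x\lor y)$; (N8) $(x\land y)\to z=x\to(y\to z)$. A Brignole algebra is an algebra $\langle A,\land_B,\rightarrowtail,0\rangle$ of type $(2,2,0)$ such that, with $\sim_B x:=x\rightarrowtail 0$ and $x\lor_B y:=((x\rightarrowtail 0)\land_B(y\rightarrowtail 0))\rightarrowtail 0$, for all $x,y,z$: (B1) $(x\rightarrowtail x)\rightarrowtail y=y$; (B2) $(x\rightarrowtail y)\land_B y=y$; (B3) $x\land_B\sim_B(x\land_B\sim_B y)=x\land_B(x\rightarrowtail y)$; (B4) $x\rightarrowtail(y\land_B z)=(x\rightarrowtail y)\land_B(x\rightarrowtail z)$; (B5) $x\rightarrowtail y=\sim_B y\rightarrowtail\sim_B x$; (B6) $x\rightarrowtail(x\rightarrowtail(y\rightarrowtail(y\rightarrowtail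 z)))=(x\land_B y)\rightarrowtail((x\land_B y)\rightarrowtail z)$; (B7) $\sim_B(\sim_B x\land_B y)\rightarrowtail(x\rightarrowtail y)=x\rightarrowtail y$; (B8) $x\land_B(x\lor_B y)=x$; (B9) $x\land_B(y\lor_B z)=(z\land_B x)\lor_B(y\land_B x)$; (B10) $(x\land_B\sim_B x)\land_B(y\lor_B\sim_B y)=x\land_B\sim_B x$. -}

module Defs where

open import Level using (Level; suc)
open import Relation.Binary.PropositionalEquality using (_≡_)

record IsNelson {a : Level} (A : Set a)
                (_∧_ _∨_ _⇒_ : A → A → A) (∼ : A → A) (𝟏 : A) : Set a where
  field
    N1 : ∀ x y → x ∧ (x ∨ y) ≡ x
    N2 : ∀ x y z → x ∧ (y ∨ z) ≡ (z ∧ x) ∨ (y ∧ x)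
    N3 : ∀ x → ∼ (∼ x) ≡ x
    N4 : ∀ x y → ∼ (x ∧ y) ≡ ∼ x ∨ ∼ y
    N5 : ∀ x y → x ∧ ∼ x ≡ (x ∧ ∼ x) ∧ (y ∨ ∼ y)
    N6 : ∀ x → x ⇒ x ≡ 𝟏
    N7 : ∀ x y → x ∧ (x ⇒ y) ≡ x ∧ (∼ x ∨ y)
    N8 : ∀ x y z → (x ∧ y) ⇒ z ≡ x ⇒ (y ⇒ z)

record NelsonAlgebra (a : Level) : Set (suc a) where
  field
    Carrier : Set a
    _∧_ _∨_ _⇒_ : Carrier → Carrier → Carrier
    ∼ : Carrier → Carrier
    𝟏 : Carrier
    isNelson : IsNelson Carrier _∧_ _∨_ _⇒_ ∼ 𝟏

record IsBrignole {a : Level} (A : Set a)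
                  (_∧B_ _↣_ : A → A → A) (𝟎 : A) : Set a where
  ∼B : A → A
  ∼B x = x ↣ 𝟎
  _∨B_ : A → A → A
  x ∨B y = ((x ↣ 𝟎) ∧B (y ↣ 𝟎)) ↣ 𝟎
  field
    B1 : ∀ x y → (x ↣ x) ↣ y ≡ y
    B2 : ∀ x y → (x ↣ y) ∧B y ≡ y
    B3 : ∀ x y → x ∧B ∼B (x ∧B ∼B y) ≡ x ∧B (x ↣ y)
    B4 : ∀ x y z → x ↣ (y ∧B z) ≡ (x ↣ y) ∧B (x ↣ z)
    B5 : ∀ x y → x ↣ y ≡ ∼B y ↣ ∼B x
    B6 : ∀ x y z → x ↣ (x ↣ (y ↣ (y ↣ z))) ≡ (x ∧B y) ↣ ((x ∧B y) ↣ z)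
    B7 : ∀ x y → ∼B (∼B x ∧B y) ↣ (x ↣ y) ≡ x ↣ y
    B8 : ∀ x y → x ∧B (x ∨B y) ≡ x
    B9 : ∀ x y z → x ∧B (y ∨B z) ≡ (z ∧B x) ∨B (y ∧B x)
    B10 : ∀ x y → (x ∧B ∼B x) ∧B (y ∨B ∼B y) ≡ x ∧B ∼B x

module NelsonToBrignole {a : Level} (N : NelsonAlgebra a) where
  open NelsonAlgebra N
  _↣_ : Carrier → Carrier → Carrier
  x ↣ y = (x ⇒ y) ∧ (∼ y ⇒ ∼ x)
  _∧B_ : Carrier → Carrier → Carrier
  x ∧B y = x ∧ y
  𝟎 : Carrier
  𝟎 = ∼ 𝟏

-- N1 and N2 are Sholander's axioms for distributive lattices, and N3–N5 make ∼
-- a Kleene involution on that lattice.  The Nelson implication ⇒ is not a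
-- residuum for ≤ but for the quasi-order  u ≼ v :⇔ u ≤ ∼u ∨ v :  u ⇒ v = 1 iff
-- u ≼ v, and z ∧ x ≼ y iff z ≼ x ⇒ y.  Inequalities are then proved by
-- Rasiowa's criterion  u ≤ w  ⇐  u ≼ w  and  ∼w ≼ ∼u,  the negative half being
-- handled by the ≼-equivalence of ∼(x ⇒ y) with x ∧ ∼y.  This gives the laws of
-- x ↣ y = (x ⇒ y) ∧ (∼y ⇒ ∼x) — x ↣ 0 = ∼x, x ↣ (x ↣ y) = x ⇒ y, distributivity
-- over ∧, contraposition — from which each Brignole axiom follows in a few steps.
module Submission where

open import Level using (Level)
open import Algebra.Core using (Op₁; Op₂)
open import Algebra.Consequences.Propositional using (comm∧distrˡ⇒distrʳ; comm∧assoc⇒middleFour)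
open import Algebra.Lattice.Bundles using (DistributiveLattice)
import Algebra.Lattice.Properties.DistributiveLattice as DistributiveLatticeProperties
open import Algebra.Lattice.Structures using (IsDistributiveLattice)
open import Data.Product using (_,_)
open import Relation.Binary.Bundles using (Poset)
open import Relation.Binary.Lattice using (Lattice)
import Relation.Binary.Lattice.Properties.JoinSemilattice as JoinSemilatticeProperties
import Relation.Binary.Lattice.Properties.MeetSemilattice as MeetSemilatticeProperties
import Relation.Binary.Reasoning.PartialOrder as PosetReasoning
open import Relation.Binary.PropositionalEquality
  using (_≡_; sym; trans; cong; cong₂; isEquivalence; module ≡-Reasoning)

open import Defs

module Sholander {a} {A : Set a} (_∧_ _∨_ : Op₂ A)
  (∧-absorbs-∨ : ∀ x y → x ∧ (x ∨ y) ≡ x)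
  (sholander : ∀ x y z → x ∧ (y ∨ z) ≡ (z ∧ x) ∨ (y ∧ x)) where

  open ≡-Reasoning

  ∧-idem : ∀ x → x ∧ x ≡ x
  ∧-idem x = begin
    x ∧ x                          ≡⟨ cong (x ∧_) (sym [x∧x]∨[x∧x]≡x) ⟩
    x ∧ ((x ∧ x) ∨ (x ∧ x))        ≡⟨ sholander x (x ∧ x) (x ∧ x) ⟩
    ((x ∧ x) ∧ x) ∨ ((x ∧ x) ∧ x)  ≡⟨ cong₂ _∨_ [x∧x]∧x≡x∧x [x∧x]∧x≡x∧x ⟩
    (x ∧ x) ∨ (x ∧ x)              ≡⟨ [x∧x]∨[x∧x]≡x ⟩
    x                              ∎
    where
    [x∧x]∨[x∧x]≡x : (x ∧ x) ∨ (x ∧ x) ≡ x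
    [x∧x]∨[x∧x]≡x = trans (sym (sholander x x x)) (∧-absorbs-∨ x x)
    [x∧x]∧x≡x∧x : (x ∧ x) ∧ x ≡ x ∧ x
    [x∧x]∧x≡x∧x = trans (cong ((x ∧ x) ∧_) (sym [x∧x]∨[x∧x]≡x)) (∧-absorbs-∨ (x ∧ x) (x ∧ x))

  [y∧x]∨x≡x : ∀ x y → (y ∧ x) ∨ x ≡ x
  [y∧x]∨x≡x x y = begin
    (y ∧ x) ∨ x        ≡⟨ cong ((y ∧ x) ∨_) (sym (∧-idem x)) ⟩
    (y ∧ x) ∨ (x ∧ x)  ≡⟨ sym (sholander x x y) ⟩
    x ∧ (x ∨ y)        ≡⟨ ∧-absorbs-∨ x y ⟩
    x                  ∎

  ∨-idem : ∀ x → x ∨ x ≡ x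
  ∨-idem x = trans (cong (_∨ x) (sym (∧-idem x))) ([y∧x]∨x≡x x x)

  ∧-comm : ∀ x y → x ∧ y ≡ y ∧ x
  ∧-comm x y = begin
    x ∧ y              ≡⟨ cong (x ∧_) (sym (∨-idem y)) ⟩
    x ∧ (y ∨ y)        ≡⟨ sholander x y y ⟩
    (y ∧ x) ∨ (y ∧ x)  ≡⟨ ∨-idem (y ∧ x) ⟩
    y ∧ x              ∎

  [x∧y]∨x≡x : ∀ x y → (x ∧ y) ∨ x ≡ x
  [x∧y]∨x≡x x y = trans (cong (_∨ x) (∧-comm x y)) ([y∧x]∨x≡x x y)

  [x∧y]∧x≡x∧y : ∀ x y → (x ∧ y) ∧ x ≡ x ∧ y
  [x∧y]∧x≡x∧y x y = trans (cong ((x ∧ y) ∧_) (sym ([x∧y]∨x≡x x y))) (∧-absorbs-∨ (x ∧ y) x)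

  ∨-absorbs-∧ : ∀ x y → x ∨ (x ∧ y) ≡ x
  ∨-absorbs-∧ x y = begin
    x ∨ (x ∧ y)                                      ≡⟨ sym (∧-idem (x ∨ (x ∧ y))) ⟩
    (x ∨ (x ∧ y)) ∧ (x ∨ (x ∧ y))                    ≡⟨ sholander (x ∨ (x ∧ y)) x (x ∧ y) ⟩
    ((x ∧ y) ∧ (x ∨ (x ∧ y))) ∨ (x ∧ (x ∨ (x ∧ y)))  ≡⟨ cong₂ _∨_ [x∧y]∧[x∨[x∧y]]≡x∧y (∧-absorbs-∨ x (x ∧ y)) ⟩
    (x ∧ y) ∨ x                                      ≡⟨ [x∧y]∨x≡x x y ⟩
    x                                                ∎
    where
    [x∧y]∧[x∨[x∧y]]≡x∧y : (x ∧ y) ∧ (x ∨ (x ∧ y)) ≡ x ∧ y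
    [x∧y]∧[x∨[x∧y]]≡x∧y = begin
      (x ∧ y) ∧ (x ∨ (x ∧ y))              ≡⟨ sholander (x ∧ y) x (x ∧ y) ⟩
      ((x ∧ y) ∧ (x ∧ y)) ∨ (x ∧ (x ∧ y))  ≡⟨ cong₂ _∨_ (∧-idem (x ∧ y)) (trans (∧-comm x (x ∧ y)) ([x∧y]∧x≡x∧y x y)) ⟩
      (x ∧ y) ∨ (x ∧ y)                    ≡⟨ ∨-idem (x ∧ y) ⟩
      x ∧ y                                ∎

  ∧-absorbs-∨ʳ : ∀ x y → x ∧ (y ∨ x) ≡ x
  ∧-absorbs-∨ʳ x y = begin
    x ∧ (y ∨ x)        ≡⟨ sholander x y x ⟩
    (x ∧ x) ∨ (y ∧ x)  ≡⟨ cong₂ _∨_ (∧-idem x) (∧-comm y x) ⟩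
    x ∨ (x ∧ y)        ≡⟨ ∨-absorbs-∧ x y ⟩
    x                  ∎

  ∨-comm : ∀ x y → x ∨ y ≡ y ∨ x
  ∨-comm x y = begin
    x ∨ y              ≡⟨ sym ([x∨y]∧[y∨x]≡x∨y x y) ⟩
    (x ∨ y) ∧ (y ∨ x)  ≡⟨ ∧-comm (x ∨ y) (y ∨ x) ⟩
    (y ∨ x) ∧ (x ∨ y)  ≡⟨ [x∨y]∧[y∨x]≡x∨y y x ⟩
    y ∨ x              ∎
    where
    [x∨y]∧[y∨x]≡x∨y : ∀ x y → (x ∨ y) ∧ (y ∨ x) ≡ x ∨ y
    [x∨y]∧[y∨x]≡x∨y x y = trans (sholander (x ∨ y) y x) (cong₂ _∨_ (∧-absorbs-∨ x y) (∧-absorbs-∨ʳ y x))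

  -- The meet order before ∧ is known to be associative: only its antisymmetry
  -- and the bound properties of ∨ and ∧ are used, never transitivity.
  private
    infix 4 _≤_
    _≤_ : A → A → Set a
    x ≤ y = x ≡ x ∧ y

    ≤-antisym : ∀ {x y} → x ≤ y → y ≤ x → x ≡ y
    ≤-antisym {x} {y} x≤y y≤x = trans x≤y (trans (∧-comm x y) (sym y≤x))

    x≤x∨y : ∀ x y → x ≤ x ∨ y
    x≤x∨y x y = sym (∧-absorbs-∨ x y)

    y≤x∨y : ∀ x y → y ≤ x ∨ y
    y≤x∨y x y = sym (∧-absorbs-∨ʳ y x)

    ∨-least : ∀ {x y z} → x ≤ z → y ≤ z → x ∨ y ≤ z
    ∨-least {x} {y} {z} x≤z y≤z = sym (begin
      (x ∨ y) ∧ z        ≡⟨ ∧-comm (x ∨ y) z ⟩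
      z ∧ (x ∨ y)        ≡⟨ sholander z x y ⟩
      (y ∧ z) ∨ (x ∧ z)  ≡⟨ cong₂ _∨_ (sym y≤z) (sym x≤z) ⟩
      y ∨ x              ≡⟨ ∨-comm y x ⟩
      x ∨ y              ∎)

    x≤y⇒x≤y∨z : ∀ {x u} v → x ≤ u → x ≤ u ∨ v
    x≤y⇒x≤y∨z {x} {u} v x≤u = sym (begin
      x ∧ (u ∨ v)        ≡⟨ sholander x u v ⟩
      (v ∧ x) ∨ (u ∧ x)  ≡⟨ cong ((v ∧ x) ∨_) (trans (∧-comm u x) (sym x≤u)) ⟩
      (v ∧ x) ∨ x        ≡⟨ [y∧x]∨x≡x x v ⟩
      x                  ∎)

    x≤y⇒x≤z∨y : ∀ {x v} u → x ≤ v → x ≤ u ∨ v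
    x≤y⇒x≤z∨y {x} {v} u x≤v = trans (x≤y⇒x≤y∨z u x≤v) (cong (x ∧_) (∨-comm v u))

  ∨-assoc : ∀ x y z → (x ∨ y) ∨ z ≡ x ∨ (y ∨ z)
  ∨-assoc x y z = ≤-antisym
    (∨-least (∨-least (x≤x∨y x (y ∨ z)) (x≤y⇒x≤z∨y x (x≤x∨y y z))) (x≤y⇒x≤z∨y x (y≤x∨y y z)))
    (∨-least (x≤y⇒x≤y∨z z (x≤x∨y x y)) (∨-least (x≤y⇒x≤y∨z z (y≤x∨y x y)) (y≤x∨y (x ∨ y) z)))

  ∨-distribˡ-∧ : ∀ x y z → x ∨ (y ∧ z) ≡ (x ∨ y) ∧ (x ∨ z)
  ∨-distribˡ-∧ x y z = sym (begin
    (x ∨ y) ∧ (x ∨ z)                    ≡⟨ sholander (x ∨ y) x z ⟩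
    (z ∧ (x ∨ y)) ∨ (x ∧ (x ∨ y))        ≡⟨ cong₂ _∨_ (sholander z x y) (∧-absorbs-∨ x y) ⟩
    ((y ∧ z) ∨ (x ∧ z)) ∨ x              ≡⟨ ∨-assoc (y ∧ z) (x ∧ z) x ⟩
    (y ∧ z) ∨ ((x ∧ z) ∨ x)              ≡⟨ cong ((y ∧ z) ∨_) ([x∧y]∨x≡x x z) ⟩
    (y ∧ z) ∨ x                          ≡⟨ ∨-comm (y ∧ z) x ⟩
    x ∨ (y ∧ z)                          ∎)

  private
    ≤⇒∨≡ : ∀ {x y} → x ≤ y → x ∨ y ≡ y
    ≤⇒∨≡ {x} {y} x≤y = trans (cong (_∨ y) x≤y) ([y∧x]∨x≡x y x)

    ∨≡⇒≤ : ∀ {x y} → x ∨ y ≡ y → x ≤ y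
    ∨≡⇒≤ {x} {y} x∨y≡y = sym (trans (cong (x ∧_) (sym x∨y≡y)) (∧-absorbs-∨ x y))

    ∧-greatest : ∀ {x y z} → x ≤ y → x ≤ z → x ≤ y ∧ z
    ∧-greatest {x} {y} {z} x≤y x≤z =
      ∨≡⇒≤ (trans (∨-distribˡ-∧ x y z) (cong₂ _∧_ (≤⇒∨≡ x≤y) (≤⇒∨≡ x≤z)))

    x∧y≤x : ∀ x y → x ∧ y ≤ x
    x∧y≤x x y = sym ([x∧y]∧x≡x∧y x y)

    x∧y≤y : ∀ x y → x ∧ y ≤ y
    x∧y≤y x y = trans (∧-comm x y) (trans (x∧y≤x y x) (cong (_∧ y) (∧-comm y x)))

    x≤y⇒x∧z≤y : ∀ {u x} z → u ≤ x → u ∧ z ≤ x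
    x≤y⇒x∧z≤y {u} {x} z u≤x = ∨≡⇒≤ (begin
      (u ∧ z) ∨ x        ≡⟨ ∨-comm (u ∧ z) x ⟩
      x ∨ (u ∧ z)        ≡⟨ ∨-distribˡ-∧ x u z ⟩
      (x ∨ u) ∧ (x ∨ z)  ≡⟨ cong (_∧ (x ∨ z)) (trans (∨-comm x u) (≤⇒∨≡ u≤x)) ⟩
      x ∧ (x ∨ z)        ≡⟨ ∧-absorbs-∨ x z ⟩
      x                  ∎)

    x≤y⇒z∧x≤y : ∀ {u x} z → u ≤ x → z ∧ u ≤ x
    x≤y⇒z∧x≤y {u} {x} z u≤x = trans (∧-comm z u) (trans (x≤y⇒x∧z≤y z u≤x) (cong (_∧ x) (∧-comm u z)))

  ∧-assoc : ∀ x y z → (x ∧ y) ∧ z ≡ x ∧ (y ∧ z)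
  ∧-assoc x y z = ≤-antisym
    (∧-greatest (x≤y⇒x∧z≤y z (x∧y≤x x y)) (∧-greatest (x≤y⇒x∧z≤y z (x∧y≤y x y)) (x∧y≤y (x ∧ y) z)))
    (∧-greatest (∧-greatest (x∧y≤x x (y ∧ z)) (x≤y⇒z∧x≤y x (x∧y≤x y z))) (x≤y⇒z∧x≤y x (x∧y≤y y z)))

  ∧-distribˡ-∨ : ∀ x y z → x ∧ (y ∨ z) ≡ (x ∧ y) ∨ (x ∧ z)
  ∧-distribˡ-∨ x y z =
    trans (sholander x y z) (trans (∨-comm (z ∧ x) (y ∧ x)) (cong₂ _∨_ (∧-comm y x) (∧-comm z x)))

  isDistributiveLattice : IsDistributiveLattice _≡_ _∨_ _∧_
  isDistributiveLattice = record
    { isLattice = record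
      { isEquivalence = isEquivalence
      ; ∨-comm        = ∨-comm
      ; ∨-assoc       = ∨-assoc
      ; ∨-cong        = cong₂ _∨_
      ; ∧-comm        = ∧-comm
      ; ∧-assoc       = ∧-assoc
      ; ∧-cong        = cong₂ _∧_
      ; absorptive    = ∨-absorbs-∧ , ∧-absorbs-∨
      }
    ; ∨-distrib-∧ = ∨-distribˡ-∧ , comm∧distrˡ⇒distrʳ ∨-comm ∨-distribˡ-∧
    ; ∧-distrib-∨ = ∧-distribˡ-∨ , comm∧distrˡ⇒distrʳ ∧-comm ∧-distribˡ-∨
    }

module KleeneLattice {a} {A : Set a} {_∨_ _∧_ : Op₂ A}
  (isDistributiveLattice : IsDistributiveLattice _≡_ _∨_ _∧_)
  (∼ : Op₁ A)
  (∼-involutive : ∀ x → ∼ (∼ x) ≡ x)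
  (∼-∧ : ∀ x y → ∼ (x ∧ y) ≡ (∼ x ∨ ∼ y))
  (kleene : ∀ x y → (x ∧ ∼ x) ≡ ((x ∧ ∼ x) ∧ (y ∨ ∼ y))) where

  -- In the order of poset, x ≤ y unfolds to x ≡ x ∧ y, so kleene x y : x ∧ ∼x ≤ y ∨ ∼y.
  private
    distributiveLattice : DistributiveLattice a a
    distributiveLattice = record { isDistributiveLattice = isDistributiveLattice }

  open DistributiveLatticeProperties distributiveLattice public using (poset; ∧-idem; ∨-idem)
  open DistributiveLatticeProperties distributiveLattice using (∨-∧-orderTheoreticLattice)
  open IsDistributiveLattice isDistributiveLattice public
    using (∧-comm; ∧-assoc; ∨-comm; ∨-assoc; ∧-distribˡ-∨; ∧-distribʳ-∨; ∨-distribˡ-∧; ∨-distribʳ-∧)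
  open Poset poset public using (_≤_; antisym)
    renaming (refl to ≤-refl; trans to ≤-trans; reflexive to ≤-reflexive)
  open Lattice ∨-∧-orderTheoreticLattice public
    using (x∧y≤x; x∧y≤y; ∧-greatest; x≤x∨y; y≤x∨y; ∨-least)
  open Lattice ∨-∧-orderTheoreticLattice using (meetSemilattice; joinSemilattice)
  open MeetSemilatticeProperties meetSemilattice public using (∧-monotonic)
  open JoinSemilatticeProperties joinSemilattice public using (∨-monotonic; x≤y⇒x∨y≈y)
  open PosetReasoning poset

  ∼-∨ : ∀ x y → ∼ (x ∨ y) ≡ (∼ x ∧ ∼ y)
  ∼-∨ x y = begin-equality
    ∼ (x ∨ y)              ≡⟨ cong ∼ (sym (cong₂ _∨_ (∼-involutive x) (∼-involutive y))) ⟩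
    ∼ (∼ (∼ x) ∨ ∼ (∼ y))  ≡⟨ cong ∼ (sym (∼-∧ (∼ x) (∼ y))) ⟩
    ∼ (∼ (∼ x ∧ ∼ y))      ≡⟨ ∼-involutive (∼ x ∧ ∼ y) ⟩
    ∼ x ∧ ∼ y              ∎

  ∼-antitone : ∀ {x y} → x ≤ y → ∼ y ≤ ∼ x
  ∼-antitone {x} {y} x≤y = begin-equality
    ∼ y        ≡⟨ cong ∼ (sym (trans (∨-comm y x) (x≤y⇒x∨y≈y x≤y))) ⟩
    ∼ (y ∨ x)  ≡⟨ ∼-∨ y x ⟩
    ∼ y ∧ ∼ x  ∎

  infix 4 _≼_
  _≼_ : A → A → Set a
  u ≼ v = u ≤ (∼ u ∨ v)

  ≤⇒≼ : ∀ {u v} → u ≤ v → u ≼ v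
  ≤⇒≼ {u} {v} u≤v = ≤-trans u≤v (y≤x∨y (∼ u) v)

  ≼-refl : ∀ {u} → u ≼ u
  ≼-refl = ≤⇒≼ ≤-refl

  ≼-reflexive : ∀ {u v} → u ≡ v → u ≼ v
  ≼-reflexive u≡v = ≤⇒≼ (≤-reflexive u≡v)

  ≼⇒∧∼≤∼ : ∀ {u v} → u ≼ v → (u ∧ ∼ v) ≤ ∼ u
  ≼⇒∧∼≤∼ {u} {v} u≼v = begin
    u ∧ ∼ v             ≡⟨ cong (_∧ ∼ v) (∼-involutive u) ⟨
    ∼ (∼ u) ∧ ∼ v       ≡⟨ ∼-∨ (∼ u) v ⟨
    ∼ (∼ u ∨ v)         ≤⟨ ∼-antitone u≼v ⟩
    ∼ u                 ∎

  ≼-split : ∀ {u v} → u ≼ v → u ≤ ((u ∧ ∼ u) ∨ (u ∧ v))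
  ≼-split {u} {v} u≼v = begin
    u                        ≤⟨ ∧-greatest ≤-refl u≼v ⟩
    u ∧ (∼ u ∨ v)            ≡⟨ ∧-distribˡ-∨ u (∼ u) v ⟩
    (u ∧ ∼ u) ∨ (u ∧ v)      ∎

  ≼-trans : ∀ {u v w} → u ≼ v → v ≼ w → u ≼ w
  ≼-trans {u} {v} {w} u≼v v≼w = begin
    u                                ≤⟨ ≼-split u≼v ⟩
    (u ∧ ∼ u) ∨ (u ∧ v)              ≤⟨ ∨-monotonic (x∧y≤y u (∼ u)) (∧-monotonic ≤-refl v≼w) ⟩
    ∼ u ∨ (u ∧ (∼ v ∨ w))            ≡⟨ cong (∼ u ∨_) (∧-distribˡ-∨ u (∼ v) w) ⟩
    ∼ u ∨ ((u ∧ ∼ v) ∨ (u ∧ w))      ≤⟨ ∨-monotonic ≤-refl (∨-monotonic (≼⇒∧∼≤∼ u≼v) (x∧y≤y u w)) ⟩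
    ∼ u ∨ (∼ u ∨ w)                  ≡⟨ ∨-assoc (∼ u) (∼ u) w ⟨
    (∼ u ∨ ∼ u) ∨ w                  ≡⟨ cong (_∨ w) (∨-idem (∼ u)) ⟩
    ∼ u ∨ w                          ∎

  ≼-greatest : ∀ {z u v} → z ≼ u → z ≼ v → z ≼ (u ∧ v)
  ≼-greatest {z} {u} {v} z≼u z≼v = begin
    z                        ≤⟨ ∧-greatest z≼u z≼v ⟩
    (∼ z ∨ u) ∧ (∼ z ∨ v)    ≡⟨ ∨-distribˡ-∧ (∼ z) u v ⟨
    ∼ z ∨ (u ∧ v)            ∎

  ≼-least : ∀ {p q w} → p ≼ w → q ≼ w → (p ∨ q) ≼ w
  ≼-least {p} {q} {w} p≼w q≼w = begin
    p ∨ q                          ≤⟨ ∨-least (∧-greatest p≼w (≤-∼∨ p≼w q≼w)) (∧-greatest (≤-∼∨ q≼w p≼w) q≼w) ⟩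
    (∼ p ∨ w) ∧ (∼ q ∨ w)          ≡⟨ ∨-distribʳ-∧ w (∼ p) (∼ q) ⟨
    (∼ p ∧ ∼ q) ∨ w                ≡⟨ cong (_∨ w) (∼-∨ p q) ⟨
    ∼ (p ∨ q) ∨ w                  ∎
    where
    ≤-∼∨ : ∀ {p q} → p ≼ w → q ≼ w → p ≤ (∼ q ∨ w)
    ≤-∼∨ {p} {q} p≼w q≼w = begin
      p                          ≤⟨ ≼-split p≼w ⟩
      (p ∧ ∼ p) ∨ (p ∧ w)        ≤⟨ ∨-monotonic (kleene p q) (x∧y≤y p w) ⟩
      (q ∨ ∼ q) ∨ w              ≤⟨ ∨-monotonic (∨-least q≼w (x≤x∨y (∼ q) w)) ≤-refl ⟩
      (∼ q ∨ w) ∨ w              ≡⟨ ∨-assoc (∼ q) w w ⟩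
      ∼ q ∨ (w ∨ w)              ≡⟨ cong (∼ q ∨_) (∨-idem w) ⟩
      ∼ q ∨ w                    ∎

  ≤∼⇒≼ : ∀ {u v} → u ≤ ∼ u → u ≼ v
  ≤∼⇒≼ {u} {v} u≤∼u = ≤-trans u≤∼u (x≤x∨y (∼ u) v)

  x∧∼x≼y : ∀ x y → (x ∧ ∼ x) ≼ y
  x∧∼x≼y x y = ≤∼⇒≼ (begin
    x ∧ ∼ x                    ≤⟨ x∧y≤y x (∼ x) ⟩
    ∼ x                        ≤⟨ x≤x∨y (∼ x) x ⟩
    ∼ x ∨ x                    ≡⟨ trans (∼-∧ x (∼ x)) (cong (∼ x ∨_) (∼-involutive x)) ⟨
    ∼ (x ∧ ∼ x)                ∎)

  ≼-∧-monotonic : ∀ {x y u v} → x ≼ y → u ≼ v → (x ∧ u) ≼ (y ∧ v)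
  ≼-∧-monotonic {x} {y} {u} {v} x≼y u≼v =
    ≼-greatest (≼-trans (≤⇒≼ (x∧y≤x x u)) x≼y) (≼-trans (≤⇒≼ (x∧y≤y x u)) u≼v)

  ≼-∨-monotonic : ∀ {x y u v} → x ≼ y → u ≼ v → (x ∨ u) ≼ (y ∨ v)
  ≼-∨-monotonic {x} {y} {u} {v} x≼y u≼v =
    ≼-least (≼-trans x≼y (≤⇒≼ (x≤x∨y y v))) (≼-trans u≼v (≤⇒≼ (y≤x∨y y v)))

  ≼⇒∼≼∼⇒≤ : ∀ {u w} → u ≼ w → ∼ w ≼ ∼ u → u ≤ w
  ≼⇒∼≼∼⇒≤ {u} {w} u≼w ∼w≼∼u = ≤-trans (≼-split u≼w) (∨-least u∧∼u≤w (x∧y≤y u w))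
    where
    u∧∼w≤w : (u ∧ ∼ w) ≤ w
    u∧∼w≤w = begin
      u ∧ ∼ w              ≡⟨ trans (∧-comm u (∼ w)) (cong (∼ w ∧_) (sym (∼-involutive u))) ⟩
      ∼ w ∧ ∼ (∼ u)        ≤⟨ ≼⇒∧∼≤∼ ∼w≼∼u ⟩
      ∼ (∼ w)              ≡⟨ ∼-involutive w ⟩
      w                    ∎
    u∧∼u≤w : (u ∧ ∼ u) ≤ w
    u∧∼u≤w = begin
      u ∧ ∼ u              ≤⟨ ∧-greatest (x∧y≤x u (∼ u)) (kleene u w) ⟩
      u ∧ (w ∨ ∼ w)        ≡⟨ ∧-distribˡ-∨ u w (∼ w) ⟩
      (u ∧ w) ∨ (u ∧ ∼ w)  ≤⟨ ∨-least (x∧y≤y u w) u∧∼w≤w ⟩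
      w                    ∎

module Nelson {a} (N : NelsonAlgebra a) where

  open NelsonAlgebra N
  open IsNelson isNelson
  open Sholander _∧_ _∨_ N1 N2 using (isDistributiveLattice)
  open KleeneLattice isDistributiveLattice ∼ N3 N4 N5
  open NelsonToBrignole N using (_↣_; 𝟎)
  open PosetReasoning poset

  x≤𝟏 : ∀ x → x ≤ 𝟏
  x≤𝟏 x = begin-equality
    x                ≡⟨ x≤x∨y x (∼ x) ⟩
    x ∧ (x ∨ ∼ x)    ≡⟨ cong (x ∧_) (∨-comm x (∼ x)) ⟩
    x ∧ (∼ x ∨ x)    ≡⟨ N7 x x ⟨
    x ∧ (x ⇒ x)      ≡⟨ cong (x ∧_) (N6 x) ⟩
    x ∧ 𝟏            ∎

  ∼𝟏≤x : ∀ x → ∼ 𝟏 ≤ x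
  ∼𝟏≤x x = begin
    ∼ 𝟏        ≤⟨ ∼-antitone (x≤𝟏 (∼ x)) ⟩
    ∼ (∼ x)    ≡⟨ N3 x ⟩
    x          ∎

  x⇒𝟏≡𝟏 : ∀ x → (x ⇒ 𝟏) ≡ 𝟏
  x⇒𝟏≡𝟏 x = begin-equality
    x ⇒ 𝟏              ≡⟨ cong (x ⇒_) (N6 x) ⟨
    x ⇒ (x ⇒ x)        ≡⟨ N8 x x x ⟨
    (x ∧ x) ⇒ x        ≡⟨ cong (_⇒ x) (∧-idem x) ⟩
    x ⇒ x              ≡⟨ N6 x ⟩
    𝟏                  ∎

  ≤⇒[⇒≡𝟏] : ∀ {u v} → u ≤ v → (u ⇒ v) ≡ 𝟏
  ≤⇒[⇒≡𝟏] {u} {v} u≤v = begin-equality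
    u ⇒ v              ≡⟨ cong (_⇒ v) u≤v ⟩
    (u ∧ v) ⇒ v        ≡⟨ N8 u v v ⟩
    u ⇒ (v ⇒ v)        ≡⟨ cong (u ⇒_) (N6 v) ⟩
    u ⇒ 𝟏              ≡⟨ x⇒𝟏≡𝟏 u ⟩
    𝟏                  ∎

  ≼⇒[⇒≡𝟏] : ∀ {u v} → u ≼ v → (u ⇒ v) ≡ 𝟏
  ≼⇒[⇒≡𝟏] {u} {v} u≼v = begin-equality
    u ⇒ v              ≡⟨ cong (_⇒ v) (∧-idem u) ⟨
    (u ∧ u) ⇒ v        ≡⟨ N8 u u v ⟩
    u ⇒ (u ⇒ v)        ≡⟨ ≤⇒[⇒≡𝟏] (trans u≼v (sym (N7 u v))) ⟩
    𝟏                  ∎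

  [⇒≡𝟏]⇒≼ : ∀ {u v} → (u ⇒ v) ≡ 𝟏 → u ≼ v
  [⇒≡𝟏]⇒≼ {u} {v} u⇒v≡𝟏 = begin-equality
    u                  ≡⟨ x≤𝟏 u ⟩
    u ∧ 𝟏              ≡⟨ cong (u ∧_) u⇒v≡𝟏 ⟨
    u ∧ (u ⇒ v)        ≡⟨ N7 u v ⟩
    u ∧ (∼ u ∨ v)      ∎

  ≼-curry : ∀ {z x y} → (z ∧ x) ≼ y → z ≼ (x ⇒ y)
  ≼-curry {z} {x} {y} z∧x≼y = [⇒≡𝟏]⇒≼ (trans (sym (N8 z x y)) (≼⇒[⇒≡𝟏] z∧x≼y))

  ⇒-mp : ∀ x y → ((x ⇒ y) ∧ x) ≼ y
  ⇒-mp x y = begin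
    (x ⇒ y) ∧ x          ≡⟨ trans (∧-comm (x ⇒ y) x) (N7 x y) ⟩
    x ∧ (∼ x ∨ y)        ≤⟨ x∧y≤y x (∼ x ∨ y) ⟩
    ∼ x ∨ y              ≤⟨ ∨-monotonic (∼-antitone (x∧y≤y (x ⇒ y) x)) ≤-refl ⟩
    ∼ ((x ⇒ y) ∧ x) ∨ y  ∎

  ≼-mp : ∀ {z x y} → z ≼ (x ⇒ y) → z ≼ x → z ≼ y
  ≼-mp {x = x} {y} z≼x⇒y z≼x = ≼-trans (≼-greatest z≼x⇒y z≼x) (⇒-mp x y)

  ≤-uncurry : ∀ {p x y} → p ≤ (x ⇒ y) → (p ∧ x) ≼ y
  ≤-uncurry {p} {x} {y} p≤x⇒y = ≼-trans (≤⇒≼ (∧-monotonic p≤x⇒y ≤-refl)) (⇒-mp x y)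

  ∼x∨∼[x⇒y]≡∼x∨[x∧∼y] : ∀ x y → (∼ x ∨ ∼ (x ⇒ y)) ≡ (∼ x ∨ (x ∧ ∼ y))
  ∼x∨∼[x⇒y]≡∼x∨[x∧∼y] x y = begin-equality
    ∼ x ∨ ∼ (x ⇒ y)          ≡⟨ N4 x (x ⇒ y) ⟨
    ∼ (x ∧ (x ⇒ y))          ≡⟨ cong ∼ (N7 x y) ⟩
    ∼ (x ∧ (∼ x ∨ y))        ≡⟨ N4 x (∼ x ∨ y) ⟩
    ∼ x ∨ ∼ (∼ x ∨ y)        ≡⟨ cong (∼ x ∨_) (∼-∨ (∼ x) y) ⟩
    ∼ x ∨ (∼ (∼ x) ∧ ∼ y)    ≡⟨ cong (λ w → ∼ x ∨ (w ∧ ∼ y)) (N3 x) ⟩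
    ∼ x ∨ (x ∧ ∼ y)          ∎

  ∼x≼x⇒y : ∀ x y → ∼ x ≼ (x ⇒ y)
  ∼x≼x⇒y x y = ≼-curry (≼-trans (≼-reflexive (cong (∼ x ∧_) (sym (N3 x)))) (x∧∼x≼y (∼ x) y))

  ∼[x⇒y]≼x∧∼y : ∀ x y → ∼ (x ⇒ y) ≼ (x ∧ ∼ y)
  ∼[x⇒y]≼x∧∼y x y = ≼-trans (≤⇒≼ ∼t≤∼t∧∼x∨∼t∧[x∧∼y])
    (≼-least (≤∼⇒≼ ∼t∧∼x≤∼[∼t∧∼x]) (≤⇒≼ (x∧y≤y (∼ t) (x ∧ ∼ y))))
    where
    -- The part of ∼(x ⇒ y) below ∼x lies below its own negation, so it is ≼ anything.
    t : Carrier
    t = x ⇒ y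
    ∼t≤∼t∧∼x∨∼t∧[x∧∼y] : ∼ t ≤ ((∼ t ∧ ∼ x) ∨ (∼ t ∧ (x ∧ ∼ y)))
    ∼t≤∼t∧∼x∨∼t∧[x∧∼y] = begin
      ∼ t                                 ≤⟨ ∧-greatest ≤-refl (y≤x∨y (∼ x) (∼ t)) ⟩
      ∼ t ∧ (∼ x ∨ ∼ t)                   ≡⟨ cong (∼ t ∧_) (∼x∨∼[x⇒y]≡∼x∨[x∧∼y] x y) ⟩
      ∼ t ∧ (∼ x ∨ (x ∧ ∼ y))             ≡⟨ ∧-distribˡ-∨ (∼ t) (∼ x) (x ∧ ∼ y) ⟩
      (∼ t ∧ ∼ x) ∨ (∼ t ∧ (x ∧ ∼ y))     ∎
    ∼t∧∼x≤∼[∼t∧∼x] : (∼ t ∧ ∼ x) ≤ ∼ (∼ t ∧ ∼ x)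
    ∼t∧∼x≤∼[∼t∧∼x] = begin
      ∼ t ∧ ∼ x                ≤⟨ x∧y≤y (∼ t) (∼ x) ⟩
      ∼ x                      ≤⟨ ∼x≼x⇒y x y ⟩
      ∼ (∼ x) ∨ t              ≡⟨ trans (cong (_∨ t) (N3 x)) (∨-comm x t) ⟩
      t ∨ x                    ≡⟨ trans (N4 (∼ t) (∼ x)) (cong₂ _∨_ (N3 t) (N3 x)) ⟨
      ∼ (∼ t ∧ ∼ x)            ∎

  x∧∼y≼∼[x⇒y] : ∀ x y → (x ∧ ∼ y) ≼ ∼ (x ⇒ y)
  x∧∼y≼∼[x⇒y] x y = begin
    x ∧ ∼ y                    ≤⟨ y≤x∨y (∼ x) (x ∧ ∼ y) ⟩
    ∼ x ∨ (x ∧ ∼ y)            ≡⟨ ∼x∨∼[x⇒y]≡∼x∨[x∧∼y] x y ⟨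
    ∼ x ∨ ∼ (x ⇒ y)            ≤⟨ ∨-monotonic (∼-antitone (x∧y≤x x (∼ y))) ≤-refl ⟩
    ∼ (x ∧ ∼ y) ∨ ∼ (x ⇒ y)    ∎

  ∼x≤x⇒y : ∀ x y → ∼ x ≤ (x ⇒ y)
  ∼x≤x⇒y x y = ≼⇒∼≼∼⇒≤ (∼x≼x⇒y x y)
    (≼-trans (∼[x⇒y]≼x∧∼y x y) (≼-trans (≤⇒≼ (x∧y≤x x (∼ y))) (≼-reflexive (sym (N3 x)))))

  y≤x⇒y : ∀ x y → y ≤ (x ⇒ y)
  y≤x⇒y x y = ≼⇒∼≼∼⇒≤ (≼-curry (≤⇒≼ (x∧y≤x y x)))
    (≼-trans (∼[x⇒y]≼x∧∼y x y) (≤⇒≼ (x∧y≤y x (∼ y))))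

  𝟏⇒x≡x : ∀ x → (𝟏 ⇒ x) ≡ x
  𝟏⇒x≡x x = begin-equality
    𝟏 ⇒ x              ≡⟨ x≤𝟏 (𝟏 ⇒ x) ⟩
    (𝟏 ⇒ x) ∧ 𝟏        ≡⟨ ∧-comm (𝟏 ⇒ x) 𝟏 ⟩
    𝟏 ∧ (𝟏 ⇒ x)        ≡⟨ N7 𝟏 x ⟩
    𝟏 ∧ (∼ 𝟏 ∨ x)      ≡⟨ cong (𝟏 ∧_) (x≤y⇒x∨y≈y (∼𝟏≤x x)) ⟩
    𝟏 ∧ x              ≡⟨ ∧-comm 𝟏 x ⟩
    x ∧ 𝟏              ≡⟨ x≤𝟏 x ⟨
    x                  ∎

  ⇒-monotonicʳ : ∀ x {y z} → y ≤ z → (x ⇒ y) ≤ (x ⇒ z)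
  ⇒-monotonicʳ x {y} {z} y≤z = ≼⇒∼≼∼⇒≤
    (≼-curry (≼-trans (⇒-mp x y) (≤⇒≼ y≤z)))
    (≼-trans (∼[x⇒y]≼x∧∼y x z)
      (≼-trans (≤⇒≼ (∧-monotonic ≤-refl (∼-antitone y≤z))) (x∧∼y≼∼[x⇒y] x y)))

  ⇒-antitoneˡ : ∀ {x y} z → x ≤ y → (y ⇒ z) ≤ (x ⇒ z)
  ⇒-antitoneˡ {x} {y} z x≤y = ≼⇒∼≼∼⇒≤
    (≼-curry (≼-trans (≤⇒≼ (∧-monotonic ≤-refl x≤y)) (⇒-mp y z)))
    (≼-trans (∼[x⇒y]≼x∧∼y x z)
      (≼-trans (≤⇒≼ (∧-monotonic x≤y ≤-refl)) (x∧∼y≼∼[x⇒y] y z)))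

  ⇒-distribˡ-∧ : ∀ x y z → (x ⇒ (y ∧ z)) ≡ ((x ⇒ y) ∧ (x ⇒ z))
  ⇒-distribˡ-∧ x y z = antisym
    (∧-greatest (⇒-monotonicʳ x (x∧y≤x y z)) (⇒-monotonicʳ x (x∧y≤y y z)))
    (≼⇒∼≼∼⇒≤ (≼-curry (≼-greatest (≤-uncurry (x∧y≤x _ _)) (≤-uncurry (x∧y≤y _ _))))
      (≼-trans (∼[x⇒y]≼x∧∼y x (y ∧ z))
        (≼-trans (≼-reflexive (trans (cong (x ∧_) (N4 y z)) (∧-distribˡ-∨ x (∼ y) (∼ z))))
          (≼-trans (≼-∨-monotonic (x∧∼y≼∼[x⇒y] x y) (x∧∼y≼∼[x⇒y] x z))
            (≼-reflexive (sym (N4 (x ⇒ y) (x ⇒ z))))))))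

  [x∨y]⇒z≡[x⇒z]∧[y⇒z] : ∀ x y z → ((x ∨ y) ⇒ z) ≡ ((x ⇒ z) ∧ (y ⇒ z))
  [x∨y]⇒z≡[x⇒z]∧[y⇒z] x y z = antisym
    (∧-greatest (⇒-antitoneˡ z (x≤x∨y x y)) (⇒-antitoneˡ z (y≤x∨y x y)))
    (≼⇒∼≼∼⇒≤
      (≼-curry (≼-trans (≼-reflexive (∧-distribˡ-∨ _ x y))
        (≼-least (≤-uncurry (x∧y≤x _ _)) (≤-uncurry (x∧y≤y _ _)))))
      (≼-trans (∼[x⇒y]≼x∧∼y (x ∨ y) z)
        (≼-trans (≼-reflexive (∧-distribʳ-∨ (∼ z) x y))
          (≼-trans (≼-∨-monotonic (x∧∼y≼∼[x⇒y] x z) (x∧∼y≼∼[x⇒y] y z))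
            (≼-reflexive (sym (N4 (x ⇒ z) (y ⇒ z))))))))

  y≤∼y⇒x : ∀ x y → y ≤ (∼ y ⇒ x)
  y≤∼y⇒x x y = begin
    y              ≡⟨ N3 y ⟨
    ∼ (∼ y)        ≤⟨ ∼x≤x⇒y (∼ y) x ⟩
    ∼ y ⇒ x        ∎

  y≤x↣y : ∀ x y → y ≤ (x ↣ y)
  y≤x↣y x y = ∧-greatest (y≤x⇒y x y) (y≤∼y⇒x (∼ x) y)

  [x↣y]∧y≡y : ∀ x y → ((x ↣ y) ∧ y) ≡ y
  [x↣y]∧y≡y x y = trans (∧-comm (x ↣ y) y) (sym (y≤x↣y x y))

  x↣x≡𝟏 : ∀ x → (x ↣ x) ≡ 𝟏
  x↣x≡𝟏 x = trans (cong₂ _∧_ (N6 x) (N6 (∼ x))) (∧-idem 𝟏)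

  𝟏↣x≡x : ∀ x → (𝟏 ↣ x) ≡ x
  𝟏↣x≡x x = trans (cong (_∧ (∼ x ⇒ ∼ 𝟏)) (𝟏⇒x≡x x)) (sym (y≤∼y⇒x (∼ 𝟏) x))

  x↣𝟎≡∼x : ∀ x → (x ↣ 𝟎) ≡ ∼ x
  x↣𝟎≡∼x x = begin-equality
    (x ⇒ ∼ 𝟏) ∧ (∼ (∼ 𝟏) ⇒ ∼ x)   ≡⟨ cong (λ w → (x ⇒ ∼ 𝟏) ∧ (w ⇒ ∼ x)) (N3 𝟏) ⟩
    (x ⇒ ∼ 𝟏) ∧ (𝟏 ⇒ ∼ x)         ≡⟨ cong ((x ⇒ ∼ 𝟏) ∧_) (𝟏⇒x≡x (∼ x)) ⟩
    (x ⇒ ∼ 𝟏) ∧ ∼ x               ≡⟨ ∧-comm (x ⇒ ∼ 𝟏) (∼ x) ⟩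
    ∼ x ∧ (x ⇒ ∼ 𝟏)               ≡⟨ ∼x≤x⇒y x (∼ 𝟏) ⟨
    ∼ x                           ∎

  ∼[x↣𝟎]≡x : ∀ x → ∼ (x ↣ 𝟎) ≡ x
  ∼[x↣𝟎]≡x x = trans (cong ∼ (x↣𝟎≡∼x x)) (N3 x)

  [x∧y]↣𝟎≡∼x∨∼y : ∀ x y → ((x ∧ y) ↣ 𝟎) ≡ (∼ x ∨ ∼ y)
  [x∧y]↣𝟎≡∼x∨∼y x y = trans (x↣𝟎≡∼x (x ∧ y)) (N4 x y)

  [x∧[y↣𝟎]]↣𝟎≡∼x∨y : ∀ x y → ((x ∧ (y ↣ 𝟎)) ↣ 𝟎) ≡ (∼ x ∨ y)
  [x∧[y↣𝟎]]↣𝟎≡∼x∨y x y = trans ([x∧y]↣𝟎≡∼x∨∼y x (y ↣ 𝟎)) (cong (∼ x ∨_) (∼[x↣𝟎]≡x y))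

  [[x↣𝟎]∧y]↣𝟎≡x∨∼y : ∀ x y → (((x ↣ 𝟎) ∧ y) ↣ 𝟎) ≡ (x ∨ ∼ y)
  [[x↣𝟎]∧y]↣𝟎≡x∨∼y x y = trans ([x∧y]↣𝟎≡∼x∨∼y (x ↣ 𝟎) y) (cong (_∨ ∼ y) (∼[x↣𝟎]≡x x))

  [x↣𝟎∧y↣𝟎]↣𝟎≡x∨y : ∀ x y → (((x ↣ 𝟎) ∧ (y ↣ 𝟎)) ↣ 𝟎) ≡ (x ∨ y)
  [x↣𝟎∧y↣𝟎]↣𝟎≡x∨y x y =
    trans ([x∧y]↣𝟎≡∼x∨∼y (x ↣ 𝟎) (y ↣ 𝟎)) (cong₂ _∨_ (∼[x↣𝟎]≡x x) (∼[x↣𝟎]≡x y))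

  x∧[x↣y]≡x∧[∼x∨y] : ∀ x y → (x ∧ (x ↣ y)) ≡ (x ∧ (∼ x ∨ y))
  x∧[x↣y]≡x∧[∼x∨y] x y = begin-equality
    x ∧ ((x ⇒ y) ∧ (∼ y ⇒ ∼ x))    ≡⟨ ∧-assoc x (x ⇒ y) (∼ y ⇒ ∼ x) ⟨
    (x ∧ (x ⇒ y)) ∧ (∼ y ⇒ ∼ x)    ≡⟨ cong (_∧ (∼ y ⇒ ∼ x)) (N7 x y) ⟩
    (x ∧ (∼ x ∨ y)) ∧ (∼ y ⇒ ∼ x)  ≡⟨ ≤-trans (x∧y≤y x (∼ x ∨ y)) (∨-least (y≤x⇒y (∼ y) (∼ x)) (y≤∼y⇒x (∼ x) y)) ⟨
    x ∧ (∼ x ∨ y)                  ∎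

  ↣-distribˡ-∧ : ∀ x y z → (x ↣ (y ∧ z)) ≡ ((x ↣ y) ∧ (x ↣ z))
  ↣-distribˡ-∧ x y z = begin-equality
    (x ⇒ (y ∧ z)) ∧ (∼ (y ∧ z) ⇒ ∼ x)                 ≡⟨ cong ((x ⇒ (y ∧ z)) ∧_) (cong (_⇒ ∼ x) (N4 y z)) ⟩
    (x ⇒ (y ∧ z)) ∧ ((∼ y ∨ ∼ z) ⇒ ∼ x)               ≡⟨ cong₂ _∧_ (⇒-distribˡ-∧ x y z) ([x∨y]⇒z≡[x⇒z]∧[y⇒z] (∼ y) (∼ z) (∼ x)) ⟩
    ((x ⇒ y) ∧ (x ⇒ z)) ∧ ((∼ y ⇒ ∼ x) ∧ (∼ z ⇒ ∼ x))  ≡⟨ comm∧assoc⇒middleFour ∧-comm ∧-assoc _ _ _ _ ⟩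
    (x ↣ y) ∧ (x ↣ z)                                 ∎

  ↣-contrapositive : ∀ x y → (x ↣ y) ≡ (∼ y ↣ ∼ x)
  ↣-contrapositive x y = begin-equality
    (x ⇒ y) ∧ (∼ y ⇒ ∼ x)              ≡⟨ ∧-comm (x ⇒ y) (∼ y ⇒ ∼ x) ⟩
    (∼ y ⇒ ∼ x) ∧ (x ⇒ y)              ≡⟨ cong₂ (λ u v → (∼ y ⇒ ∼ x) ∧ (u ⇒ v)) (N3 x) (N3 y) ⟨
    (∼ y ⇒ ∼ x) ∧ (∼ (∼ x) ⇒ ∼ (∼ y))  ∎

  ∼[x↣y]≼x∧∼y : ∀ x y → ∼ (x ↣ y) ≼ (x ∧ ∼ y)
  ∼[x↣y]≼x∧∼y x y = ≼-trans (≼-reflexive (N4 (x ⇒ y) (∼ y ⇒ ∼ x)))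
    (≼-least (∼[x⇒y]≼x∧∼y x y)
      (≼-trans (∼[x⇒y]≼x∧∼y (∼ y) (∼ x)) (≼-reflexive (trans (cong (∼ y ∧_) (N3 x)) (∧-comm (∼ y) x)))))

  x∧∼y≼∼[x↣y] : ∀ x y → (x ∧ ∼ y) ≼ ∼ (x ↣ y)
  x∧∼y≼∼[x↣y] x y = ≼-trans (x∧∼y≼∼[x⇒y] x y)
    (≤⇒≼ (≤-trans (x≤x∨y _ _) (≤-reflexive (sym (N4 (x ⇒ y) (∼ y ⇒ ∼ x))))))

  x↣[x↣y]≤x⇒y : ∀ x y → (x ↣ (x ↣ y)) ≤ (x ⇒ y)
  x↣[x↣y]≤x⇒y x y = ≼⇒∼≼∼⇒≤
    (≼-curry (≼-mp (≼-trans (≤-uncurry (x∧y≤x _ _)) (≤⇒≼ (x∧y≤x _ _))) (≤⇒≼ (x∧y≤y _ _))))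
    (≼-trans (∼[x⇒y]≼x∧∼y x y)
      (≼-trans (≼-greatest (≤⇒≼ (x∧y≤x _ _)) (x∧∼y≼∼[x↣y] x y)) (x∧∼y≼∼[x↣y] x (x ↣ y))))

  x⇒y≤x↣[x↣y] : ∀ x y → (x ⇒ y) ≤ (x ↣ (x ↣ y))
  x⇒y≤x↣[x↣y] x y = ≼⇒∼≼∼⇒≤
    (≼-greatest
      (≼-curry (≼-greatest (≤⇒≼ (x∧y≤x _ _)) (≼-curry [x⇒y]∧x∧∼y≼∼x)))
      (≼-curry (≼-trans (≼-∧-monotonic ≼-refl (∼[x↣y]≼x∧∼y x y))
        (≼-trans (≼-reflexive (sym (∧-assoc (x ⇒ y) x (∼ y)))) [x⇒y]∧x∧∼y≼∼x))))
    (≼-trans (∼[x↣y]≼x∧∼y x (x ↣ y))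
      (≼-trans (≤⇒≼ (x∧y≤y _ _)) (≼-trans (∼[x↣y]≼x∧∼y x y) (x∧∼y≼∼[x⇒y] x y))))
    where
    [x⇒y]∧x∧∼y≼∼x : (((x ⇒ y) ∧ x) ∧ ∼ y) ≼ ∼ x
    [x⇒y]∧x∧∼y≼∼x = ≼-trans (≼-∧-monotonic (⇒-mp x y) ≼-refl) (x∧∼x≼y y (∼ x))

  x↣[x↣y]≡x⇒y : ∀ x y → (x ↣ (x ↣ y)) ≡ (x ⇒ y)
  x↣[x↣y]≡x⇒y x y = antisym (x↣[x↣y]≤x⇒y x y) (x⇒y≤x↣[x↣y] x y)

  [x∨∼y]↣[x↣y]≡x↣y : ∀ x y → ((x ∨ ∼ y) ↣ (x ↣ y)) ≡ (x ↣ y)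
  [x∨∼y]↣[x↣y]≡x↣y x y = antisym
    (≼⇒∼≼∼⇒≤
      (≼-greatest
        (≼-curry (≼-mp (≼-trans (L∧v≼s (x≤x∨y x (∼ y))) (≤⇒≼ (x∧y≤x _ _))) (≤⇒≼ (x∧y≤y _ _))))
        (≼-curry (≼-mp (≼-trans (L∧v≼s (y≤x∨y x (∼ y))) (≤⇒≼ (x∧y≤y _ _))) (≤⇒≼ (x∧y≤y _ _)))))
      (≼-trans (∼[x↣y]≼x∧∼y x y)
        (≼-trans (≼-greatest (≤⇒≼ (≤-trans (x∧y≤x _ _) (x≤x∨y x (∼ y)))) (x∧∼y≼∼[x↣y] x y))
          (x∧∼y≼∼[x↣y] u s))))
    (y≤x↣y u s)
    where
    u s : Carrier
    u = x ∨ ∼ y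
    s = x ↣ y
    L∧v≼s : ∀ {v} → v ≤ u → ((u ↣ s) ∧ v) ≼ s
    L∧v≼s v≤u = ≼-mp (≤⇒≼ (≤-trans (x∧y≤x _ _) (x∧y≤x _ _))) (≤⇒≼ (≤-trans (x∧y≤y _ _) v≤u))

mainTheorem4 : {a : Level} (N : NelsonAlgebra a) →
    IsBrignole (NelsonAlgebra.Carrier N) (NelsonToBrignole._∧B_ N) (NelsonToBrignole._↣_ N) (NelsonToBrignole.𝟎 N)
mainTheorem4 N = record
  { B1 = λ x y → trans (cong (_↣ y) (x↣x≡𝟏 x)) (𝟏↣x≡x y)
  ; B2 = [x↣y]∧y≡y
  ; B3 = λ x y → trans (cong (x ∧_) ([x∧[y↣𝟎]]↣𝟎≡∼x∨y x y)) (sym (x∧[x↣y]≡x∧[∼x∨y] x y))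
  ; B4 = ↣-distribˡ-∧
  ; B5 = λ x y → trans (↣-contrapositive x y) (sym (cong₂ _↣_ (x↣𝟎≡∼x y) (x↣𝟎≡∼x x)))
  ; B6 = λ x y z → trans (x↣[x↣y]≡x⇒y x _) (trans (cong (x ⇒_) (x↣[x↣y]≡x⇒y y z))
                     (trans (sym (N8 x y z)) (sym (x↣[x↣y]≡x⇒y (x ∧ y) z))))
  ; B7 = λ x y → trans (cong (_↣ (x ↣ y)) ([[x↣𝟎]∧y]↣𝟎≡x∨∼y x y)) ([x∨∼y]↣[x↣y]≡x↣y x y)
  ; B8 = λ x y → trans (cong (x ∧_) ([x↣𝟎∧y↣𝟎]↣𝟎≡x∨y x y)) (N1 x y)
  ; B9 = λ x y z → trans (cong (x ∧_) ([x↣𝟎∧y↣𝟎]↣𝟎≡x∨y y z))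
                     (trans (N2 x y z) (sym ([x↣𝟎∧y↣𝟎]↣𝟎≡x∨y (z ∧ x) (y ∧ x))))
  ; B10 = λ x y → trans (cong₂ _∧_ (cong (x ∧_) (x↣𝟎≡∼x x))
                            (trans ([x↣𝟎∧y↣𝟎]↣𝟎≡x∨y y (y ↣ 𝟎)) (cong (y ∨_) (x↣𝟎≡∼x y))))
                    (trans (sym (N5 x y)) (cong (x ∧_) (sym (x↣𝟎≡∼x x))))
  }
  where
  open NelsonAlgebra N
  open IsNelson isNelson
  open NelsonToBrignole N using (_↣_; 𝟎)
  open Nelson N
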